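{- Let $G$ be a finite simple graph and let $x$ be a vertex of $G$ belonging to some s-module of $G$. Then $\mathrm{sduo}(G - x) \subsetneq \mathrm{sduo}(G)$.
   Context: A subset $M \subseteq V(G)$ is a module of the graph $G$ if for all $x,y \in M$ and all $v \in V(G)\setminus M$, $v$ is adjacent to $x$ iff $v$ is adjacent to $y$. A stable set is a subset $S$ with $|S|\ge 2$ containing no edge of $G$; an s-module is a module that is a stable set. An s-duo is an s-module of cardinality $2$, and $\mathrm{sduo}(G)$ denotes the set of s-duos of $G$. $G - x$ is the subgraph induced by $V(G)\setminus\{x\}$. -}

module Defs where

open import Data.Nat using (ℕ; _≥_)
open import Data.Fin using (Fin)
open import Data.Fin.Subset using (Subset; _∈_; _∉_; _⊆_; ∣_∣; ⁅_⁆; ∁; ⊤)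
open import Data.Bool using (Bool; true; false)
open import Data.Product using (_×_; ∃)
open import Relation.Nullary using (¬_)
open import Relation.Binary.PropositionalEquality using (_≡_)
open import Function.Bundles using (_⇔_)

record Graph (n : ℕ) : Set where
  field
    adj   : Fin n → Fin n → Bool
    sym   : ∀ u v → adj u v ≡ adj v u
    irrefl : ∀ v → adj v v ≡ false
open Graph public

-- Notions for the subgraph of G induced by a vertex set W ⊆ Fin n.
module _ {n : ℕ} (G : Graph n) (W : Subset n) where

  IsModule : Subset n → Set
  IsModule M = M ⊆ W × (∀ x y v → x ∈ M → y ∈ M → v ∈ W → v ∉ M →
                         (adj G v x ≡ true ⇔ adj G v y ≡ true))

  IsStable : Subset n → Set
  IsStable S = S ⊆ W × ∣ S ∣ ≥ 2 × (∀ x y → x ∈ S → y ∈ S → adj G x y ≡ false)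

  IsSModule : Subset n → Set
  IsSModule M = IsModule M × IsStable M

  IsSDuo : Subset n → Set
  IsSDuo M = IsSModule M × ∣ M ∣ ≡ 2

sduo : ∀ {n} → Graph n → Subset n → Set
sduo G = IsSDuo G ⊤

-- sduo(G - x) : G - x is induced on V(G) \ {x}
sduo-del : ∀ {n} → Graph n → Fin n → Subset n → Set
sduo-del G x = IsSDuo G (∁ ⁅ x ⁆)

_⊊ₚ_ : ∀ {n} → (Subset n → Set) → (Subset n → Set) → Set
P ⊊ₚ Q = (∀ D → P D → Q D) × ∃ (λ D → Q D × ¬ P D)

-- Let M be a stable module containing x and pick y ≠ x in M. Any two vertices
-- of M form an s-duo of G, so {x, y} ∈ sduo(G) while x ∉ V(G - x). Conversely,
-- an s-module D of G - x is a module of G because x sees D uniformly: if x ~ p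
-- for some p ∈ D, then p ∉ M, so p ~ y; hence y ∉ D, so y ~ q for every q ∈ D;
-- then q ∉ M, so q ~ x as well.
module Submission where

open import Defs hiding (sym)
open import Data.Nat using (ℕ; suc; _≤_)
import Data.Nat.Properties as ℕ
open import Data.Fin using (Fin; _≟_; zero; suc)
open import Data.Fin.Subset using (Subset; _∈_; _∉_; _⊆_; ⊤; ⁅_⁆; _∪_; ∣_∣; ∁)
open import Data.Fin.Subset.Properties
open import Data.Fin.Properties using (any?)
open import Data.Bool using (true)
open import Data.Product using (_×_; ∃; _,_)
open import Data.Sum using (inj₁; inj₂)
open import Data.Empty using (⊥-elim)
open import Relation.Nullary using (¬_; yes; no; contradiction)
open import Relation.Nullary.Decidable using (_×-dec_; ¬?)
open import Relation.Binary.PropositionalEquality using (_≡_; _≢_; refl; sym; trans; cong)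
open import Function.Bundles using (_⇔_; mk⇔; Equivalence)

∣⁅x⁆∪⁅y⁆∣≡2 : ∀ {n} {x y : Fin n} → x ≢ y → ∣ ⁅ x ⁆ ∪ ⁅ y ⁆ ∣ ≡ 2
∣⁅x⁆∪⁅y⁆∣≡2 {x = zero}  {zero}  x≢y = contradiction refl x≢y
∣⁅x⁆∪⁅y⁆∣≡2 {x = zero}  {suc y} _   rewrite ∪-identityˡ ⁅ y ⁆ = cong suc (∣⁅x⁆∣≡1 y)
∣⁅x⁆∪⁅y⁆∣≡2 {x = suc x} {zero}  _   rewrite ∪-identityʳ ⁅ x ⁆ = cong suc (∣⁅x⁆∣≡1 x)
∣⁅x⁆∪⁅y⁆∣≡2 {x = suc x} {suc y} x≢y = ∣⁅x⁆∪⁅y⁆∣≡2 (λ x≡y → x≢y (cong suc x≡y))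

∃-∈-≢ : ∀ {n} {p : Subset n} (x : Fin n) → 2 ≤ ∣ p ∣ → ∃ λ y → y ∈ p × y ≢ x
∃-∈-≢ {p = p} x 2≤∣p∣ with any? (λ y → (y ∈? p) ×-dec ¬? (y ≟ x))
... | yes found = found
... | no none =
  ⊥-elim (ℕ.<⇒≱ 2≤∣p∣ (ℕ.≤-trans (p⊆q⇒∣p∣≤∣q∣ p⊆⁅x⁆) (ℕ.≤-reflexive (∣⁅x⁆∣≡1 x))))
  where
  p⊆⁅x⁆ : p ⊆ ⁅ x ⁆
  p⊆⁅x⁆ {y} y∈p with y ≟ x
  ... | yes refl = x∈⁅x⁆ x
  ... | no y≢x = ⊥-elim (none (y , y∈p , y≢x))

∈∁⁅x⁆ : ∀ {n} {x y : Fin n} → y ≢ x → y ∈ ∁ ⁅ x ⁆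
∈∁⁅x⁆ y≢x = x∉p⇒x∈∁p (x≢y⇒x∉⁅y⁆ y≢x)

module _ {n : ℕ} (G : Graph n) where

  infix 4 _~_
  _~_ : Fin n → Fin n → Set
  u ~ v = adj G u v ≡ true

  ~-sym : ∀ {u v} → u ~ v → v ~ u
  ~-sym {u} {v} u~v = trans (Graph.sym G v u) u~v

  module _ {W M : Subset n} where

    module-~ : IsModule G W M → ∀ {v p q} → p ∈ M → q ∈ M → v ∈ W → v ∉ M →
               v ~ p → v ~ q
    module-~ (_ , modM) p∈M q∈M v∈W v∉M = Equivalence.to (modM _ _ _ p∈M q∈M v∈W v∉M)

    stable-≁ : IsStable G W M → ∀ {p q} → p ∈ M → q ∈ M → ¬ p ~ q
    stable-≁ (_ , _ , noEdge) p∈M q∈M p~q with () ← trans (sym p~q) (noEdge _ _ p∈M q∈M)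

    sModule-⊆ : IsSModule G W M → ∀ {D} → D ⊆ M → 2 ≤ ∣ D ∣ → IsSModule G W D
    sModule-⊆ ((M⊆W , modM) , stM@(_ , _ , noEdge)) {D} D⊆M 2≤∣D∣ =
      (⊆-trans D⊆M M⊆W , modD) , (⊆-trans D⊆M M⊆W , 2≤∣D∣ , λ p q p∈D q∈D → noEdge p q (D⊆M p∈D) (D⊆M q∈D))
      where
      modD : ∀ p q v → p ∈ D → q ∈ D → v ∈ W → v ∉ D → v ~ p ⇔ v ~ q
      modD p q v p∈D q∈D v∈W _ with v ∈? M
      ... | yes v∈M = mk⇔ (λ v~p → contradiction v~p (stable-≁ stM v∈M (D⊆M p∈D)))
                          (λ v~q → contradiction v~q (stable-≁ stM v∈M (D⊆M q∈D)))
      ... | no v∉M = modM p q v (D⊆M p∈D) (D⊆M q∈D) v∈W v∉M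

  module _ {M : Subset n} (modM : IsModule G ⊤ M) (stM : IsStable G ⊤ M) {x y : Fin n}
           (x∈M : x ∈ M) (y∈M : y ∈ M) (y≢x : y ≢ x) where

    private
      modM-~ : ∀ {v p q} → p ∈ M → q ∈ M → v ∉ M → v ~ p → v ~ q
      modM-~ p∈M q∈M = module-~ modM p∈M q∈M ∈⊤

    deleted-sModule-~ : ∀ {D} → IsSModule G (∁ ⁅ x ⁆) D → ∀ {p q} → p ∈ D → q ∈ D →
                        x ~ p → x ~ q
    deleted-sModule-~ {D} (modD , stD) {p} {q} p∈D q∈D x~p = ~-sym q~x
      where
      p∉M : p ∉ M
      p∉M p∈M = stable-≁ stM x∈M p∈M x~p
      p~y : p ~ y
      p~y = modM-~ x∈M y∈M p∉M (~-sym x~p)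
      y∉D : y ∉ D
      y∉D y∈D = stable-≁ stD p∈D y∈D p~y
      y~q : y ~ q
      y~q = module-~ modD p∈D q∈D (∈∁⁅x⁆ y≢x) y∉D (~-sym p~y)
      q∉M : q ∉ M
      q∉M q∈M = stable-≁ stM y∈M q∈M y~q
      q~x : q ~ x
      q~x = modM-~ y∈M x∈M q∉M (~-sym y~q)

    deleted-sModule⇒sModule : ∀ {D} → IsSModule G (∁ ⁅ x ⁆) D → IsSModule G ⊤ D
    deleted-sModule⇒sModule {D} sD@((_ , modD) , (_ , 2≤∣D∣ , noEdge)) =
      ((λ _ → ∈⊤) , modG) , ((λ _ → ∈⊤) , 2≤∣D∣ , noEdge)
      where
      modG : ∀ p q v → p ∈ D → q ∈ D → v ∈ ⊤ → v ∉ D → v ~ p ⇔ v ~ q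
      modG p q v p∈D q∈D _ v∉D with v ≟ x
      ... | yes refl = mk⇔ (deleted-sModule-~ sD p∈D q∈D) (deleted-sModule-~ sD q∈D p∈D)
      ... | no v≢x = modD p q v p∈D q∈D (∈∁⁅x⁆ v≢x) v∉D

lemma2 : (n : ℕ) (G : Graph n) (x : Fin n) →
         ∃ (λ (M : Subset n) → IsSModule G ⊤ M × x ∈ M) →
         sduo-del G x ⊊ₚ sduo G
lemma2 n G x (M , sM@(modM , stM@(_ , 2≤∣M∣ , _)) , x∈M) with ∃-∈-≢ x 2≤∣M∣
... | y , y∈M , y≢x = sduo-del⊆sduo , (duo , duo∈sduo , duo∉sduo-del)
  where
  sduo-del⊆sduo : ∀ D → sduo-del G x D → sduo G D
  sduo-del⊆sduo D (sD , ∣D∣≡2) = deleted-sModule⇒sModule G modM stM x∈M y∈M y≢x sD , ∣D∣≡2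
  duo : Subset n
  duo = ⁅ x ⁆ ∪ ⁅ y ⁆
  duo⊆M : duo ⊆ M
  duo⊆M z∈duo with x∈p∪q⁻ ⁅ x ⁆ ⁅ y ⁆ z∈duo
  ... | inj₁ z∈⁅x⁆ rewrite x∈⁅y⁆⇒x≡y _ z∈⁅x⁆ = x∈M
  ... | inj₂ z∈⁅y⁆ rewrite x∈⁅y⁆⇒x≡y _ z∈⁅y⁆ = y∈M
  ∣duo∣≡2 : ∣ duo ∣ ≡ 2
  ∣duo∣≡2 = ∣⁅x⁆∪⁅y⁆∣≡2 (λ x≡y → y≢x (sym x≡y))
  duo∈sduo : sduo G duo
  duo∈sduo = sModule-⊆ G sM duo⊆M (ℕ.≤-reflexive (sym ∣duo∣≡2)) , ∣duo∣≡2
  duo∉sduo-del : ¬ sduo-del G x duo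
  duo∉sduo-del (((duo⊆∁⁅x⁆ , _) , _) , _) =
    x∈∁p⇒x∉p (duo⊆∁⁅x⁆ (x∈p∪q⁺ (inj₁ (x∈⁅x⁆ x)))) (x∈⁅x⁆ x)
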